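{- Deterministically, the total cost of all induced epochs is at most $O(1)$ times the total cost of all original and final epochs.
   Context: Setting: $G=(V,E)$ is a dynamic graph on a fixed set $V$ of $n$ vertices that starts with no edges and undergoes a sequence of updates, each the insertion or deletion of one edge. A fixed integer $\Delta>0$ upper-bounds the maximum degree of $G$ at all times, and $\mathcal{C}=\{1,\dots,\Delta+1\}$ is the set of colors. Let $L=\lceil\log_3(n-1)\rceil-1$. The algorithm maintains a coloring $\chi:V\to\mathcal{C}$ and a level $\ell(v)\in\{ -1,0,\dots,L\}$ for each vertex $v$. For an edge $uv$, $u$ is an up-neighbor of $v$ if $\ell(u)\ge\ell(v)$ and a down-neighbor of $v$ if $\ell(u)<\ell(v)$. For a level $k$, $\phi_v(k)$ is the number of neighbors $u$ of $v$ with $\ell(u)<k$. A color $c$ is blank for $v$ if no neighbor of $v$ has color $c$, and unique for $v$ if no up-neighbor of $v$ has color $c$ and exactly one down-neighbor of $v$ has color $c$. Algorithm: initially every vertex is at level $-1$ with an arbitrary color. A deletion changes nothing. On insertion of an edge $uv$: if $\chi(u)\neq\chi(v)$ nothing changes; otherwise let $x$ be the endpoint among $u,v$ that was recolored most recently, and repeat $x\leftarrow\texttt{recolor}(x)$ until $x=\mathrm{NULL}$. The procedure $\texttt{recolor}(x)$: if $\phi_x(\ell(x)+1)<3^{\ell(x)+2}$, call $\texttt{det-color}(x)$, which assigns to $x$ a deterministically chosen blank color, sets $\ell(x)=-1$, and then return NULL. Otherwise call $\texttt{rand-color}(x)$, which: lets $\ell'$ be the minimum level $\ell'>\ell(x)$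 with $\phi_x(\ell'+1)<3^{\ell'+2}$ and sets $\ell(x)=\ell'$; picks uniformly at random a color $c$ among the colors that are blank or unique for $x$ and sets $\chi(x)=c$; returns NULL if $c$ is blank for $x$, and otherwise returns the unique down-neighbor $y$ of $x$ with $\chi(y)=c$. The implementation is such that $\texttt{det-color}(x)$ takes $O(3^{\ell(x)})$ time ($\ell(x)$ the level at the start of the call) and $\texttt{rand-color}(x)$ takes $O(3^{\ell'})$ time ($\ell'$ the new level). Epochs: an epoch $\mathcal{E}$ of a vertex $v=v(\mathcal{E})$ is a maximal time interval during which $v$ keeps the same color; it starts with a call to $\texttt{recolor}(v)$ and ends immediately before the next call to $\texttt{recolor}(v)$, if any. Its level $\ell(\mathcal{E})$ is the (constant) level of $v$ during $\mathcal{E}$. An epoch is final if it is not ended by a call to $\texttt{recolor}(v)$. A non-final epoch is original if the call $\texttt{recolor}(v)$ ending it is triggered by the insertion of an edge $uv$ with $\chi(u)=\chi(v)$, and induced if that call is made because $\texttt{rand-color}(w)$ for some up-neighbor $w$ of $v$ returned $v$. The cost $c(\mathcal{E})$ of an epoch is the running time of the call to $\texttt{recolor}(v(\mathcal{E}))$ that starts it, where in addition the cost of every epoch at level $-1$ is reassigned to the previous epoch of the same vertex; with this convention $c(\mathcal{E})=O(3^{\ell(\mathcal{E})})$ for every epoch $\mathcal{E}$. -}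

module Defs where

open import Data.Nat using (ℕ; zero; suc; _+_; _*_; _^_; _≤_; _<_; _<ᵇ_)
open import Data.Fin using (Fin; _≟_)
open import Data.Bool using (Bool; true; false; if_then_else_; _∧_; _∨_)
open import Data.List using (List; []; _∷_; [_]; _++_; map; allFin)
open import Data.Nat.ListAction using (sum)
open import Data.Product using (_×_; _,_)
open import Data.Sum using (_⊎_)
open import Relation.Binary.PropositionalEquality using (_≡_; _≢_)
open import Relation.Nullary using (¬_)
open import Relation.Nullary.Decidable using (⌊_⌋)

-- Conventions:
--  * vertices are Fin n, colours are Fin (suc Δ)  (i.e. {1,…,Δ+1});
--  * a level ℓ ∈ {-1,0,1,…} is stored SHIFTED as k = ℓ + 1 ∈ ℕ;
--  * the cost of an epoch of (shifted) level k is 3 ^ k  (= 3^(ℓ+1) = Θ(3^ℓ)).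

data Kind : Set where
  original induced : Kind

module Algorithm (n Δ : ℕ) where

  Vertex : Set
  Vertex = Fin n

  Color : Set
  Color = Fin (suc Δ)

  record State : Set where
    constructor mkState
    field
      adj   : Vertex → Vertex → Bool
      col   : Vertex → Color
      lvl   : Vertex → ℕ               -- shifted level ℓ(v)+1
      stamp : Vertex → ℕ               -- 0 = never recoloured, else time of last recolour
      clock : ℕ
  open State public

  -- one call to recolor(x): which vertex, why its previous epoch ended,
  -- the (shifted) level of x just before the call (= level of the ended epoch),
  -- and the (shifted) level of the new epoch.
  record Call : Set where
    constructor call
    field
      who    : Vertex
      kind   : Kind
      oldLvl : ℕ
      newLvl : ℕ
  open Call public

  override : {A : Set} → (Vertex → A) → Vertex → A → Vertex → A
  override f x a y = if ⌊ y ≟ x ⌋ then a else f y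

  count : (Vertex → Bool) → ℕ
  count p = sum (map (λ u → if p u then 1 else 0) (allFin n))

  Nbr : State → Vertex → Vertex → Set
  Nbr s x u = adj s x u ≡ true

  deg : State → Vertex → ℕ
  deg s v = count (adj s v)

  MaxDeg : State → Set
  MaxDeg s = ∀ v → deg s v ≤ Δ

  -- φ_v(m) with the shifted argument j = m + 1 : number of neighbours u with ℓ(u) < m
  φ : State → Vertex → ℕ → ℕ
  φ s v j = count (λ u → adj s v u ∧ (lvl s u <ᵇ j))

  -- for shifted level k (ℓ = k - 1):  φ_x(ℓ+1) < 3^(ℓ+2)
  Low : State → Vertex → ℕ → Set
  Low s x k = φ s x (suc k) < 3 ^ suc k

  MinLevel : State → Vertex → ℕ → Set
  MinLevel s x k′ = lvl s x < k′ × Low s x k′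
                    × (∀ j → lvl s x < j → j < k′ → ¬ Low s x j)

  UpNbr DownNbr : State → Vertex → Vertex → Set
  UpNbr s x u = Nbr s x u × lvl s x ≤ lvl s u
  DownNbr s x u = Nbr s x u × lvl s u < lvl s x

  Blank : State → Vertex → Color → Set
  Blank s x c = ∀ u → Nbr s x u → col s u ≢ c

  UniqueVia : State → Vertex → Color → Vertex → Set
  UniqueVia s x c y = (∀ u → UpNbr s x u → col s u ≢ c)
                      × DownNbr s x y × col s y ≡ c
                      × (∀ u → DownNbr s x u → col s u ≡ c → u ≡ y)

  setLvl : State → Vertex → ℕ → State
  setLvl s x k = record s { lvl = override (lvl s) x k }

  recol : State → Vertex → Color → ℕ → State
  recol s x c k = record s
    { col = override (col s) x c
    ; lvl = override (lvl s) x k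
    ; stamp = override (stamp s) x (suc (clock s))
    ; clock = suc (clock s) }

  -- The chain  x ← recolor(x)  until NULL, started with a call of kind κ on x.
  -- Random choices (and the deterministic choice in det-color) range over
  -- all admissible outcomes.
  data Chain : Kind → Vertex → State → List Call → State → Set where
    det-color : ∀ {κ x s c} → Low s x (lvl s x) → Blank s x c →
      Chain κ x s [ call x κ (lvl s x) 0 ] (recol s x c 0)
    rand-blank : ∀ {κ x s c k′} → ¬ Low s x (lvl s x) → MinLevel s x k′ →
      Blank (setLvl s x k′) x c →
      Chain κ x s [ call x κ (lvl s x) k′ ] (recol s x c k′)
    rand-unique : ∀ {κ x s c k′ y cs s′} → ¬ Low s x (lvl s x) → MinLevel s x k′ →
      UniqueVia (setLvl s x k′) x c y →
      Chain induced y (recol s x c k′) cs s′ →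
      Chain κ x s (call x κ (lvl s x) k′ ∷ cs) s′

  data Update : Set where
    ins del : Vertex → Vertex → Update

  setEdge : State → Vertex → Vertex → Bool → State
  setEdge s u v b = record s
    { adj = λ a w → if (⌊ a ≟ u ⌋ ∧ ⌊ w ≟ v ⌋) ∨ (⌊ a ≟ v ⌋ ∧ ⌊ w ≟ u ⌋) then b else adj s a w }

  -- endpoint recoloured most recently (ties, possible only if neither was ever recoloured, either way)
  MostRecent : State → Vertex → Vertex → Vertex → Set
  MostRecent s u v x = (x ≡ u × stamp s v ≤ stamp s u) ⊎ (x ≡ v × stamp s u ≤ stamp s v)

  data Step : State → Update → List Call → State → Set where
    ins-ok : ∀ {s u v} → u ≢ v → adj s u v ≡ false → MaxDeg (setEdge s u v true) →
      col s u ≢ col s v → Step s (ins u v) [] (setEdge s u v true)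
    ins-conflict : ∀ {s u v x cs s′} → u ≢ v → adj s u v ≡ false → MaxDeg (setEdge s u v true) →
      col s u ≡ col s v → MostRecent s u v x →
      Chain original x (setEdge s u v true) cs s′ → Step s (ins u v) cs s′
    delete : ∀ {s u v} → adj s u v ≡ true → Step s (del u v) [] (setEdge s u v false)

  data Exec : State → List Call → State → Set where
    start : ∀ {s} → Exec s [] s
    next : ∀ {s cs s₁ up cs′ s₂} → Exec s cs s₁ → Step s₁ up cs′ s₂ → Exec s (cs ++ cs′) s₂

  initState : (Vertex → Color) → State
  initState χ₀ = mkState (λ _ _ → false) χ₀ (λ _ → 0) (λ _ → 0) 0

  epochCost : ℕ → ℕ
  epochCost k = 3 ^ k

  isInduced isOriginal : Kind → Bool
  isInduced induced = true
  isInduced original = false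
  isOriginal original = true
  isOriginal induced = false

  -- every non-final epoch is ended by exactly one call; its level is the call's oldLvl
  inducedCost : List Call → ℕ
  inducedCost cs = sum (map (λ c → if isInduced (kind c) then epochCost (oldLvl c) else 0) cs)

  originalCost : List Call → ℕ
  originalCost cs = sum (map (λ c → if isOriginal (kind c) then epochCost (oldLvl c) else 0) cs)

  -- the final epoch of each vertex has its level in the final state
  finalCost : State → ℕ
  finalCost s = sum (map (λ v → epochCost (lvl s v)) (allFin n))

module Submission where

-- The proof is an amortisation with the potential Φ(s) = finalCost s, the total
-- cost of the epochs currently in progress (3 ^ level of every vertex).
--  * Telescoping: every call ends one epoch (at its old level) and starts one
--    (at its new level), changing Φ by exactly that difference.  Summed over a
--    run from s₀ to s:  startCost cs + Φ(s₀) ≡ endCost cs + Φ(s).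
--  * Charging: an induced call on y is made by rand-color(x), and y is a
--    down-neighbour of x, so y's ended epoch lies at least one level below the
--    epoch x has just started; hence 3 · (its cost) ≤ the cost of x's new epoch.
--    Summing over a chain, and then over a run:  3 · inducedCost ≤ startCost.
--  * Combining: 3 I ≤ startCost ≤ endCost + Φ(s) = I + (O + Φ(s)), so I ≤ O + Φ(s).

open import Defs
open import Data.Nat using (ℕ; _+_; _*_; _≤_; _<_)
open import Data.Fin using (Fin)
open import Data.Product using (∃-syntax)

open import Data.Nat using (zero; suc; z≤n)
open import Data.Nat.Properties
  using (+-assoc; +-identityʳ; +-cancelʳ-≡; +-cancelˡ-≤; +-mono-≤; +-monoˡ-≤; +-monoʳ-≤;
         m≤m+n; ≤-trans; ≤-reflexive; *-identityˡ; *-distribˡ-+; ^-monoʳ-≤;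
         +-0-commutativeMonoid; +-commutativeSemigroup; module ≤-Reasoning)
open import Data.Fin using (_≟_; punchIn)
open import Data.Fin.Properties using (punchInᵢ≢i)
open import Data.Bool using (if_then_else_)
open import Data.List using (List; []; _∷_; _++_; map; tabulate; allFin)
open import Data.List.Properties using (map-++; map-tabulate)
open import Data.Nat.ListAction using (sum)
open import Data.Nat.ListAction.Properties using (sum-++)
open import Data.Vec.Functional using (removeAt)
open import Data.Product using (_,_)
open import Relation.Binary.PropositionalEquality
  using (_≡_; _≢_; refl; sym; trans; cong; cong₂; module ≡-Reasoning)
open import Relation.Nullary using (yes; no)
open import Relation.Nullary.Negation using (contradiction)
open import Data.Nat.Tactic.RingSolver using (solve-∀)
open import Algebra.Properties.CommutativeSemigroup +-commutativeSemigroup using (x∙yz≈y∙xz)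
import Algebra.Properties.CommutativeMonoid.Sum +-0-commutativeMonoid as Σ

sum-map-++ : ∀ {A : Set} (f : A → ℕ) xs ys →
             sum (map f (xs ++ ys)) ≡ sum (map f xs) + sum (map f ys)
sum-map-++ f xs ys = trans (cong sum (map-++ f xs ys)) (sum-++ (map f xs) (map f ys))

sum-allFin : ∀ {m} (f : Fin m → ℕ) → sum (map f (allFin m)) ≡ Σ.sum f
sum-allFin f = trans (cong sum (map-tabulate (λ i → i) f)) (sum-tabulate f)
  where
    sum-tabulate : ∀ {k} (g : Fin k → ℕ) → sum (tabulate g) ≡ Σ.sum g
    sum-tabulate {zero}  g = refl
    sum-tabulate {suc k} g = cong (g Fin.zero +_) (sum-tabulate (λ i → g (Fin.suc i)))

-- Changing a function at a single point x changes its sum by the change at x;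
-- stated without subtraction as  g x + Σ f ≡ f x + Σ g.
sum-update : ∀ {m} (f g : Fin m → ℕ) x → (∀ y → y ≢ x → f y ≡ g y) →
             g x + Σ.sum f ≡ f x + Σ.sum g
sum-update {suc m} f g x agree = begin
  g x + Σ.sum f                        ≡⟨ cong (g x +_) (Σ.sum-remove f) ⟩
  g x + (f x + Σ.sum (removeAt f x))   ≡⟨ x∙yz≈y∙xz (g x) (f x) _ ⟩
  f x + (g x + Σ.sum (removeAt f x))   ≡⟨ cong (λ t → f x + (g x + t)) same-rest ⟩
  f x + (g x + Σ.sum (removeAt g x))   ≡⟨ cong (f x +_) (sym (Σ.sum-remove g)) ⟩
  f x + Σ.sum g                        ∎
  where
    open ≡-Reasoning
    same-rest : Σ.sum (removeAt f x) ≡ Σ.sum (removeAt g x)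
    same-rest = Σ.sum-cong-≗ (λ j → agree (punchIn x j) (punchInᵢ≢i x j))

telescope : ∀ {a b a′ b′ p q r : ℕ} → a + p ≡ b + q → a′ + q ≡ b′ + r →
            (a + a′) + p ≡ (b + b′) + r
telescope {a} {b} {a′} {b′} {p} {q} {r} first second = +-cancelʳ-≡ q _ _ (begin
  (a + a′) + p + q     ≡⟨ interleave a a′ p q ⟩
  (a + p) + (a′ + q)   ≡⟨ cong₂ _+_ first second ⟩
  (b + q) + (b′ + r)   ≡⟨ regather b b′ q r ⟩
  (b + b′) + r + q     ∎)
  where
    open ≡-Reasoning
    interleave : ∀ u u′ w v → (u + u′) + w + v ≡ (u + w) + (u′ + v)
    interleave = solve-∀
    regather : ∀ u u′ w v → (u + w) + (u′ + v) ≡ (u + u′) + v + w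
    regather = solve-∀

third-bound : ∀ i x → 3 * i ≤ i + x → i ≤ x
third-bound i x three-i≤ = ≤-trans (m≤m+n i (i + 0)) (+-cancelˡ-≤ i (2 * i) x three-i≤)

module Analysis (n Δ : ℕ) where
  open Algorithm n Δ

  -- Each call starts an epoch (at its new level) and ends one (at its old level).
  startCost endCost : List Call → ℕ
  startCost cs = sum (map (λ c → epochCost (newLvl c)) cs)
  endCost cs = sum (map (λ c → epochCost (oldLvl c)) cs)

  inducedShare : Kind → ℕ → ℕ
  inducedShare κ l = if isInduced κ then epochCost l else 0

  override-self : ∀ {A : Set} (f : Vertex → A) x a → override f x a x ≡ a
  override-self f x a with x ≟ x
  ... | yes _   = refl
  ... | no x≢x = contradiction refl x≢x

  override-other : ∀ {A : Set} (f : Vertex → A) x a y → y ≢ x → f y ≡ override f x a y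
  override-other f x a y y≢x with y ≟ x
  ... | yes y≡x = contradiction y≡x y≢x
  ... | no _    = refl

  endCost-split : ∀ cs → endCost cs ≡ inducedCost cs + originalCost cs
  endCost-split [] = refl
  endCost-split (call _ original l _ ∷ cs) = begin
    epochCost l + endCost cs                         ≡⟨ cong (epochCost l +_) (endCost-split cs) ⟩
    epochCost l + (inducedCost cs + originalCost cs) ≡⟨ x∙yz≈y∙xz (epochCost l) (inducedCost cs) (originalCost cs) ⟩
    inducedCost cs + (epochCost l + originalCost cs) ∎
    where open ≡-Reasoning
  endCost-split (call _ induced l _ ∷ cs) =
    trans (cong (epochCost l +_) (endCost-split cs)) (sym (+-assoc (epochCost l) _ _))

  recol-balance : ∀ s x c k →
                  epochCost k + finalCost s ≡ epochCost (lvl s x) + finalCost (recol s x c k)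
  recol-balance s x c k = begin
    epochCost k + finalCost s                    ≡⟨ cong₂ _+_ (cong epochCost (sym (override-self (lvl s) x k)))
                                                              (sum-allFin old) ⟩
    new x + Σ.sum old                            ≡⟨ sum-update old new x
                                                      (λ y y≢x → cong epochCost (override-other (lvl s) x k y y≢x)) ⟩
    epochCost (lvl s x) + Σ.sum new              ≡⟨ cong (epochCost (lvl s x) +_) (sym (sum-allFin new)) ⟩
    epochCost (lvl s x) + finalCost (recol s x c k) ∎
    where
      open ≡-Reasoning
      old new : Vertex → ℕ
      old v = epochCost (lvl s v)
      new v = epochCost (override (lvl s) x k v)

  chain-balance : ∀ {κ x s cs s′} → Chain κ x s cs s′ →
                  startCost cs + finalCost s ≡ endCost cs + finalCost s′
  chain-balance {s = s} (det-color {x = x} {c = c} _ _) =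
    telescope {epochCost 0} {epochCost (lvl s x)} {0} {0} (recol-balance s x c 0) refl
  chain-balance {s = s} (rand-blank {x = x} {c = c} {k′ = k′} _ _ _) =
    telescope {epochCost k′} {epochCost (lvl s x)} {0} {0} (recol-balance s x c k′) refl
  chain-balance {s = s} (rand-unique {x = x} {c = c} {k′ = k′} {cs = cs} _ _ _ rest) =
    telescope {epochCost k′} {epochCost (lvl s x)} {startCost cs} {endCost cs}
              (recol-balance s x c k′) (chain-balance rest)

  -- The vertex y handed on by rand-color(x) is a down-neighbour of x, so its
  -- (ending) epoch is at least one level below x's new level k′.
  handoff-cheaper : ∀ {s x c k′ y} → UniqueVia (setLvl s x k′) x c y →
                    3 * epochCost (lvl (recol s x c k′) y) ≤ epochCost k′
  handoff-cheaper {s} {x} {k′ = k′} (_ , (_ , y-below) , _) rewrite override-self (lvl s) x k′ =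
    ^-monoʳ-≤ 3 y-below

  last-call : ∀ p q → 3 * (p + 0) ≤ 3 * p + q
  last-call p q = ≤-trans (≤-reflexive (cong (3 *_) (+-identityʳ p))) (m≤m+n (3 * p) q)

  -- Charging along a chain: three times the induced cost is paid by the epochs
  -- started in the chain, plus the chain's first ended epoch if that one is induced.
  chain-charge : ∀ {κ x s cs s′} → Chain κ x s cs s′ →
                 3 * inducedCost cs ≤ 3 * inducedShare κ (lvl s x) + startCost cs
  chain-charge {κ} {x} {s} (det-color _ _) = last-call (inducedShare κ (lvl s x)) _
  chain-charge {κ} {x} {s} (rand-blank _ _ _) = last-call (inducedShare κ (lvl s x)) _
  chain-charge {κ} {x} {s} (rand-unique {c = c} {k′ = k′} {y = y} {cs = cs} _ _ unique rest) = begin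
    3 * (p + inducedCost cs)                        ≡⟨ *-distribˡ-+ 3 p (inducedCost cs) ⟩
    3 * p + 3 * inducedCost cs                      ≤⟨ +-monoʳ-≤ (3 * p) (chain-charge rest) ⟩
    3 * p + (3 * epochCost (lvl s′ y) + startCost cs)
      ≤⟨ +-monoʳ-≤ (3 * p) (+-monoˡ-≤ (startCost cs) (handoff-cheaper {s} {x} {c} {k′} {y} unique)) ⟩
    3 * p + (epochCost k′ + startCost cs)           ∎
    where
      open ≤-Reasoning
      p : ℕ
      p = inducedShare κ (lvl s x)
      s′ : State
      s′ = recol s x c k′

  step-balance : ∀ {s up cs s′} → Step s up cs s′ →
                 startCost cs + finalCost s ≡ endCost cs + finalCost s′
  step-balance (ins-ok _ _ _ _)               = refl
  step-balance (ins-conflict _ _ _ _ _ chain) = chain-balance chain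
  step-balance (delete _)                     = refl

  -- A conflict chain starts with an original call, so nothing extra is owed.
  step-charge : ∀ {s up cs s′} → Step s up cs s′ → 3 * inducedCost cs ≤ startCost cs
  step-charge (ins-ok _ _ _ _)               = z≤n
  step-charge (ins-conflict _ _ _ _ _ chain) = chain-charge chain
  step-charge (delete _)                     = z≤n

  exec-balance : ∀ {s cs s′} → Exec s cs s′ →
                 startCost cs + finalCost s ≡ endCost cs + finalCost s′
  exec-balance start = refl
  exec-balance (next {cs = cs} {cs′ = cs′} run step) = begin
    startCost (cs ++ cs′) + _          ≡⟨ cong (_+ _) (sum-map-++ _ cs cs′) ⟩
    (startCost cs + startCost cs′) + _ ≡⟨ telescope {startCost cs} {endCost cs} {startCost cs′} {endCost cs′}
                                                    (exec-balance run) (step-balance step) ⟩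
    (endCost cs + endCost cs′) + _     ≡⟨ cong (_+ _) (sym (sum-map-++ _ cs cs′)) ⟩
    endCost (cs ++ cs′) + _            ∎
    where open ≡-Reasoning

  exec-charge : ∀ {s cs s′} → Exec s cs s′ → 3 * inducedCost cs ≤ startCost cs
  exec-charge start = z≤n
  exec-charge (next {cs = cs} {cs′ = cs′} run step) = begin
    3 * inducedCost (cs ++ cs′)               ≡⟨ cong (3 *_) (sum-map-++ _ cs cs′) ⟩
    3 * (inducedCost cs + inducedCost cs′)    ≡⟨ *-distribˡ-+ 3 (inducedCost cs) _ ⟩
    3 * inducedCost cs + 3 * inducedCost cs′  ≤⟨ +-mono-≤ (exec-charge run) (step-charge step) ⟩
    startCost cs + startCost cs′              ≡⟨ sym (sum-map-++ _ cs cs′) ⟩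
    startCost (cs ++ cs′)                     ∎
    where open ≤-Reasoning

  induced-bound : ∀ {s₀ cs s} → Exec s₀ cs s → inducedCost cs ≤ originalCost cs + finalCost s
  induced-bound {s₀} {cs} {s} run = third-bound I (originalCost cs + finalCost s) (begin
    3 * I                                  ≤⟨ exec-charge run ⟩
    startCost cs                           ≤⟨ m≤m+n _ (finalCost s₀) ⟩
    startCost cs + finalCost s₀            ≡⟨ exec-balance run ⟩
    endCost cs + finalCost s               ≡⟨ cong (_+ finalCost s) (endCost-split cs) ⟩
    I + originalCost cs + finalCost s      ≡⟨ +-assoc I _ _ ⟩
    I + (originalCost cs + finalCost s)    ∎)
    where
      open ≤-Reasoning
      I : ℕ
      I = inducedCost cs

-- The constant is C = 1.
lemma4 : ∃[ C ] ∀ (n Δ : ℕ) → 0 < Δ → (χ₀ : Fin n → Fin (ℕ.suc Δ)) → ∀ {cs s} →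
           Algorithm.Exec n Δ (Algorithm.initState n Δ χ₀) cs s →
           Algorithm.inducedCost n Δ cs ≤ C * (Algorithm.originalCost n Δ cs + Algorithm.finalCost n Δ s)
lemma4 = 1 , λ n Δ _ _ run →
  ≤-trans (Analysis.induced-bound n Δ run) (≤-reflexive (sym (*-identityˡ _)))
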